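{- Let $s$ be a perfect square (a positive integer of the form $s=m^2$). Then there do not exist positive integers $d,u,v$ with $\frac{4}{s}=\frac{1}{duv}+\frac{1}{dus}+\frac{1}{dvs}$; that is, $s$ has no Type B solution (whether or not of Type II).
   Context: A Type B solution for a positive integer $a$ is a triple $(duv,dua,dva)$ with $d,u,v$ positive integers satisfying $\frac{4}{a}=\frac{1}{duv}+\frac{1}{dua}+\frac{1}{dva}$. -}

module Defs where

open import Data.Nat using (ℕ; zero; suc; _*_; _<_)
open import Data.Integer using (+_)
open import Data.Rational using (ℚ; _/_; _+_; 0ℚ)
open import Data.Product using (Σ; _×_; ∃-syntax)
open import Relation.Binary.PropositionalEquality using (_≡_)

-- Convention: the value at n = 0 is 0 (only ever used with n > 0 below,
-- since all denominators are products of positive integers).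
_÷ℕ_ : ℕ → ℕ → ℚ
k ÷ℕ zero  = 0ℚ
k ÷ℕ suc n = (+ k) / suc n

HasTypeBSolution : ℕ → Set
HasTypeBSolution a =
  ∃[ d ] ∃[ u ] ∃[ v ]
    (0 < d × 0 < u × 0 < v ×
     (4 ÷ℕ a) ≡ (1 ÷ℕ (d * u * v)) + (1 ÷ℕ (d * u * a)) + (1 ÷ℕ (d * v * a)))

module Submission where

-- Clearing denominators turns 4/s = 1/(duv) + 1/(dus) + 1/(dvs) into 4duv = s + u + v, that is
-- (4du − 1) v = s + u; multiplying by 4d gives d (2m)² ≡ −1 modulo N = 4du − 1 when s = m².
-- This is refuted with Gauss's lemma for the odd modulus N = 2h + 1: let gauss c be the parity of
-- the number of k ∈ [1, h] for which the residue of c k exceeds h.  On units gauss is a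
-- homomorphism to (Bool, xor), because k ↦ |c k| (least absolute residue) permutes [1, h]; hence
-- gauss (d t²) = gauss d.  But gauss (−1) is the parity of h = 2du − 1, which is odd, while
-- gauss d is even: d · 2u = h + 1, so k ↦ [d k mod N > h] vanishes on [0, 2u) and changes value
-- under k ↦ k + 2u, and [0, h] splits into d blocks of the even length 2u.

open import Defs
open import Data.Nat
  using (ℕ; zero; suc; pred; _+_; _*_; _∸_; _≤_; _<_; _%_; NonZero; z≤n; z<s; s≤s; s≤s⁻¹; >-nonZero⁻¹)
open import Relation.Nullary using (¬_; does; yes; no)

open import Algebra.Bundles using (CommutativeMonoid; CommutativeRing)
open import Data.Bool using (Bool; true; false; not; _xor_; if_then_else_)
open import Data.Bool.Properties using (xor-∧-commutativeRing; xor-assoc; xor-comm; xor-same; xor-identityʳ; not-involutive)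
open import Data.Fin using (Fin; toℕ; fromℕ<)
open import Data.Fin.Permutation using (Permutation; permutation)
open import Data.Fin.Properties using (toℕ<n; toℕ-fromℕ<; toℕ-injective)
import Data.Integer as ℤ
open import Data.Integer.Properties using (+-injective)
open import Data.List using (_∷_; [])
open import Data.Nat.DivMod
open import Data.Nat.Properties
open import Data.Nat.Tactic.RingSolver using (solve; solve-∀)
open import Data.Product using (_×_; _,_; ∃-syntax)
open import Data.Rational as ℚ using (toℚᵘ)
open import Data.Rational.Properties using (toℚᵘ-fromℚᵘ; toℚᵘ-cong; toℚᵘ-homo-+)
open import Data.Rational.Unnormalised using (mkℚᵘ; *≡*) renaming (_≃_ to _≃ᵘ_; _+_ to _+ᵘ_)
open import Data.Rational.Unnormalised.Properties using (≃-trans; ≃-sym) renaming (+-cong to +ᵘ-cong)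
open import Function using (_∘_)
open import Relation.Binary.PropositionalEquality
open import Relation.Nullary.Decidable using (dec-true; dec-false)
open import Relation.Nullary.Negation using (contradiction)

clear-denominators : ∀ M A B C .{{_ : NonZero M}} .{{_ : NonZero A}} .{{_ : NonZero B}} .{{_ : NonZero C}} →
  4 ÷ℕ M ≡ 1 ÷ℕ A ℚ.+ 1 ÷ℕ B ℚ.+ 1 ÷ℕ C → 4 * (A * B * C) ≡ (B * C + A * C + A * B) * M
clear-denominators M@(suc M-1) A@(suc A-1) B@(suc B-1) C@(suc C-1) eq with unnormalised
  where
  ÷ℕ-toℚᵘ : ∀ k n → toℚᵘ (k ÷ℕ suc n) ≃ᵘ mkℚᵘ (ℤ.+ k) n
  ÷ℕ-toℚᵘ k n = toℚᵘ-fromℚᵘ (mkℚᵘ (ℤ.+ k) n)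

  unnormalised : mkℚᵘ (ℤ.+ 4) M-1 ≃ᵘ mkℚᵘ (ℤ.+ 1) A-1 +ᵘ mkℚᵘ (ℤ.+ 1) B-1 +ᵘ mkℚᵘ (ℤ.+ 1) C-1
  unnormalised = ≃-trans (≃-sym (÷ℕ-toℚᵘ 4 M-1)) (≃-trans (toℚᵘ-cong eq)
    (≃-trans (toℚᵘ-homo-+ (1 ÷ℕ A ℚ.+ 1 ÷ℕ B) (1 ÷ℕ C))
      (+ᵘ-cong (≃-trans (toℚᵘ-homo-+ (1 ÷ℕ A) (1 ÷ℕ B)) (+ᵘ-cong (÷ℕ-toℚᵘ 1 A-1) (÷ℕ-toℚᵘ 1 B-1)))
               (÷ℕ-toℚᵘ 1 C-1))))
... | *≡* cross = trans (+-injective cross) (cong (_* M) (normalise A B C))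
  where
  normalise : ∀ A B C → (1 * B + 1 * A) * C + 1 * (A * B) ≡ B * C + A * C + A * B
  normalise = solve-∀

typeB⇒4duv≡s+u+v : ∀ {s d u v} → 0 < s → 0 < d → 0 < u → 0 < v →
  4 ÷ℕ s ≡ 1 ÷ℕ (d * u * v) ℚ.+ 1 ÷ℕ (d * u * s) ℚ.+ 1 ÷ℕ (d * v * s) →
  4 * d * u * v ≡ s + u + v
typeB⇒4duv≡s+u+v {s@(suc _)} {d@(suc _)} {u@(suc _)} {v@(suc _)} _ _ _ _ eq =
  *-cancelʳ-≡ (4 * d * u * v) (s + u + v) (d * d * u * v * s * s) (begin
    4 * d * u * v * (d * d * u * v * s * s)   ≡⟨ regroupˡ d u v s ⟩
    4 * (A * B * C)                           ≡⟨ clear-denominators s A B C eq ⟩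
    (B * C + A * C + A * B) * s               ≡⟨ regroupʳ d u v s ⟩
    (s + u + v) * (d * d * u * v * s * s)     ∎)
  where
  open ≡-Reasoning
  A B C : ℕ
  A = d * u * v
  B = d * u * s
  C = d * v * s
  regroupˡ : ∀ d u v s → 4 * d * u * v * (d * d * u * v * s * s) ≡ 4 * (d * u * v * (d * u * s) * (d * v * s))
  regroupˡ = solve-∀
  regroupʳ : ∀ d u v s → ((d * u * s) * (d * v * s) + (d * u * v) * (d * v * s) + (d * u * v) * (d * u * s)) * s
                         ≡ (s + u + v) * (d * d * u * v * s * s)
  regroupʳ = solve-∀

typeB-congruence : ∀ {n d u v s} .{{_ : NonZero n}} →
  4 * d * u ≡ suc n → 4 * d * u * v ≡ s + u + v → (d * (4 * s) + 1) % n ≡ 0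
typeB-congruence {n} {d} {u} {v} {s} 4du≡1+n 4duv≡s+u+v = begin
  (d * (4 * s) + 1) % n       ≡⟨ [m+n]%n≡m%n (d * (4 * s) + 1) n ⟨
  (d * (4 * s) + 1 + n) % n   ≡⟨ cong (_% n) multiple ⟩
  (4 * d * v * n) % n         ≡⟨ m*n%n≡0 (4 * d * v) n ⟩
  0                           ∎
  where
  open ≡-Reasoning
  nv≡s+u : n * v ≡ s + u
  nv≡s+u = +-cancelˡ-≡ v (n * v) (s + u) (begin
    suc n * v       ≡⟨ cong (_* v) 4du≡1+n ⟨
    4 * d * u * v   ≡⟨ 4duv≡s+u+v ⟩
    s + u + v       ≡⟨ +-comm (s + u) v ⟩
    v + (s + u)     ∎)
  multiple : d * (4 * s) + 1 + n ≡ 4 * d * v * n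
  multiple = begin
    d * (4 * s) + 1 + n     ≡⟨ solve (d ∷ s ∷ n ∷ []) ⟩
    4 * d * s + suc n       ≡⟨ cong (4 * d * s +_) 4du≡1+n ⟨
    4 * d * s + 4 * d * u   ≡⟨ *-distribˡ-+ (4 * d) s u ⟨
    4 * d * (s + u)         ≡⟨ cong (4 * d *_) nv≡s+u ⟨
    4 * d * (n * v)         ≡⟨ solve (d ∷ n ∷ v ∷ []) ⟩
    4 * d * v * n           ∎

xor-commutativeMonoid : CommutativeMonoid _ _
xor-commutativeMonoid = CommutativeRing.+-commutativeMonoid xor-∧-commutativeRing

open import Algebra.Properties.CommutativeMonoid.Sum xor-commutativeMonoid
  using (sum-syntax; sum-cong-≗; sum-replicate; sum-permute; ∑-distrib-+)
open import Algebra.Properties.Monoid.Mult (CommutativeMonoid.monoid xor-commutativeMonoid)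
  using (×-homo-+) renaming (_×_ to _times_)

double-times≡false : ∀ n b → (n + n) times b ≡ false
double-times≡false n b = trans (×-homo-+ b n n) (xor-same (n times b))

∑-split : ∀ m n (f : ℕ → Bool) →
  ∑[ i < m + n ] f (toℕ i) ≡ ∑[ i < m ] f (toℕ i) xor ∑[ i < n ] f (m + toℕ i)
∑-split zero    n f = refl
∑-split (suc m) n f = trans (cong (f 0 xor_) (∑-split m n (f ∘ suc))) (sym (xor-assoc (f 0) _ _))

∑-antiperiodic : ∀ u j (f : ℕ → Bool) →
  (∀ k → k < u + u → f k ≡ f 0) →
  (∀ k → u + u + k < j * (u + u) → f (u + u + k) ≡ not (f k)) →
  ∑[ i < j * (u + u) ] f (toℕ i) ≡ false
∑-antiperiodic u zero    f _     _    = refl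
∑-antiperiodic u (suc j) f const anti =
  trans (∑-split U (j * U) f) (cong₂ _xor_ first-block (rest j anti))
  where
  U : ℕ
  U = u + u

  first-block : ∑[ i < U ] f (toℕ i) ≡ false
  first-block = trans (sum-cong-≗ (λ i → const (toℕ i) (toℕ<n i)))
                      (trans (sum-replicate U) (double-times≡false u (f 0)))

  rest : ∀ j → (∀ k → U + k < suc j * U → f (U + k) ≡ not (f k)) →
         ∑[ i < j * U ] f (U + toℕ i) ≡ false
  rest zero    _    = refl
  rest (suc j) anti = ∑-antiperiodic u (suc j) (λ k → f (U + k)) const′
    (λ k lt → anti (U + k) (+-monoʳ-< U lt))
    where
    inFirstTwo : ∀ {k} → k < U → U + k < suc (suc j) * U
    inFirstTwo k<U = +-monoʳ-< U (<-≤-trans k<U (m≤m+n U (j * U)))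

    const′ : ∀ k → k < U → f (U + k) ≡ f (U + 0)
    const′ k k<U = trans (anti k (inFirstTwo k<U))
      (trans (cong not (const k k<U)) (sym (anti 0 (inFirstTwo (<-≤-trans z<s k<U)))))

module Modulo (n : ℕ) .{{_ : NonZero n}} where

  infix 4 _≋_
  _≋_ : ℕ → ℕ → Set
  a ≋ b = a % n ≡ b % n

  0%n≡0 : 0 % n ≡ 0
  0%n≡0 = m<n⇒m%n≡m (>-nonZero⁻¹ n)

  %-≋ : ∀ a → a % n ≋ a
  %-≋ a = m%n%n≡m%n a n

  +-≋ : ∀ {a a′ b b′} → a ≋ a′ → b ≋ b′ → a + b ≋ a′ + b′
  +-≋ {a} {a′} {b} {b′} a≋a′ b≋b′ = begin
    (a + b) % n             ≡⟨ %-distribˡ-+ a b n ⟩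
    (a % n + b % n) % n     ≡⟨ cong₂ (λ x y → (x + y) % n) a≋a′ b≋b′ ⟩
    (a′ % n + b′ % n) % n   ≡⟨ %-distribˡ-+ a′ b′ n ⟨
    (a′ + b′) % n           ∎
    where open ≡-Reasoning

  *-≋ : ∀ {a a′ b b′} → a ≋ a′ → b ≋ b′ → a * b ≋ a′ * b′
  *-≋ {a} {a′} {b} {b′} a≋a′ b≋b′ = begin
    (a * b) % n             ≡⟨ %-distribˡ-* a b n ⟩
    (a % n * (b % n)) % n   ≡⟨ cong₂ (λ x y → (x * y) % n) a≋a′ b≋b′ ⟩
    (a′ % n * (b′ % n)) % n ≡⟨ %-distribˡ-* a′ b′ n ⟨
    (a′ * b′) % n           ∎
    where open ≡-Reasoning

  *n≋0 : ∀ a → a * n ≋ 0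
  *n≋0 a = trans (m*n%n≡0 a n) (sym 0%n≡0)

  n≋0 : n ≋ 0
  n≋0 = trans (n%n≡0 n) (sym 0%n≡0)

  negation-unique : ∀ {a b c} → a + c ≋ 0 → b + c ≋ 0 → a ≋ b
  negation-unique {a} {b} {c} a+c≋0 b+c≋0 = begin
    a % n               ≡⟨ cong (_% n) (+-identityʳ a) ⟨
    (a + 0) % n         ≡⟨ +-≋ {a} refl b+c≋0 ⟨
    (a + (b + c)) % n   ≡⟨ cong (_% n) (solve (a ∷ b ∷ c ∷ [])) ⟩
    (a + c + b) % n     ≡⟨ +-≋ a+c≋0 refl ⟩
    b % n               ∎
    where open ≡-Reasoning

  *∸-negates : ∀ a {r} → r ≤ n → a * (n ∸ r) + a * r ≋ 0
  *∸-negates a {r} r≤n = begin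
    (a * (n ∸ r) + a * r) % n ≡⟨ cong (_% n) (*-distribˡ-+ a (n ∸ r) r) ⟨
    (a * (n ∸ r + r)) % n     ≡⟨ cong (λ x → (a * x) % n) (m∸n+n≡m r≤n) ⟩
    (a * n) % n               ≡⟨ *n≋0 a ⟩
    0 % n                     ∎
    where open ≡-Reasoning

  negate-residue : ∀ a b → a + b ≋ 0 → b % n ≢ 0 → a % n ≡ n ∸ b % n
  negate-residue a b a+b≋0 b≢0 = begin
    a % n             ≡⟨ negation-unique a+b≋0 minus-b ⟩
    (n ∸ b % n) % n   ≡⟨ m<n⇒m%n≡m (∸-monoʳ-< (n≢0⇒n>0 b≢0) (m%n≤n b n)) ⟩
    n ∸ b % n         ∎
    where
    open ≡-Reasoning
    minus-b : n ∸ b % n + b ≋ 0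
    minus-b = trans (+-≋ {n ∸ b % n} {n ∸ b % n} {b} refl (sym (%-≋ b)))
                    (trans (cong (_% n) (m∸n+n≡m (m%n≤n b n))) n≋0)

  IsUnit : ℕ → Set
  IsUnit a = ∃[ a′ ] a * a′ ≋ 1

  unit-nonzero : ∀ {b k} → IsUnit b → k % n ≢ 0 → b * k % n ≢ 0
  unit-nonzero {b} {k} (b′ , bb′≋1) k≢0 bk≡0 = k≢0 (begin
    k % n               ≡⟨ cong (_% n) (*-identityˡ k) ⟨
    (1 * k) % n         ≡⟨ *-≋ bb′≋1 refl ⟨
    (b * b′ * k) % n    ≡⟨ cong (_% n) (solve (b ∷ b′ ∷ k ∷ [])) ⟩
    (b′ * (b * k)) % n  ≡⟨ *-≋ {b′} refl (trans bk≡0 (sym 0%n≡0)) ⟩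
    (b′ * 0) % n        ≡⟨ cong (_% n) (*-zeroʳ b′) ⟩
    0 % n               ≡⟨ 0%n≡0 ⟩
    0                   ∎)
    where open ≡-Reasoning

module Interval (h : ℕ) where

  ι : Fin h → ℕ
  ι i = suc (toℕ i)

  MapsInterval : (ℕ → ℕ) → Set
  MapsInterval f = ∀ {k} → 0 < k → k ≤ h → 0 < f k × f k ≤ h

  private
    pred<h : ∀ {m} → 0 < m → m ≤ h → pred m < h
    pred<h {suc _} _ m≤h = m≤h

    restrict : ∀ {f} → MapsInterval f → Fin h → Fin h
    restrict mf i with mf {ι i} z<s (toℕ<n i)
    ... | 0<fk , fk≤h = fromℕ< (pred<h 0<fk fk≤h)

    ι-restrict : ∀ {f} (mf : MapsInterval f) i → ι (restrict mf i) ≡ f (ι i)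
    ι-restrict {f} mf i with f (ι i) | mf {ι i} z<s (toℕ<n i)
    ... | suc _ | _ , fk≤h = cong suc (toℕ-fromℕ< fk≤h)

    restrict-inverse : ∀ {f g} (mf : MapsInterval f) (mg : MapsInterval g) →
      (∀ {k} → 0 < k → k ≤ h → g (f k) ≡ k) → ∀ i → restrict mg (restrict mf i) ≡ i
    restrict-inverse {f} {g} mf mg gf i = toℕ-injective (suc-injective (begin
      ι (restrict mg (restrict mf i)) ≡⟨ ι-restrict mg (restrict mf i) ⟩
      g (ι (restrict mf i))           ≡⟨ cong g (ι-restrict mf i) ⟩
      g (f (ι i))                     ≡⟨ gf z<s (toℕ<n i) ⟩
      ι i                             ∎))
      where open ≡-Reasoning

  ∑-bijection : ∀ {f g} → MapsInterval f → MapsInterval g →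
    (∀ {k} → 0 < k → k ≤ h → g (f k) ≡ k) → (∀ {k} → 0 < k → k ≤ h → f (g k) ≡ k) →
    ∀ F → ∑[ i < h ] F (f (ι i)) ≡ ∑[ i < h ] F (ι i)
  ∑-bijection {f} mf mg gf fg F = begin
    ∑[ i < h ] F (f (ι i))               ≡⟨ sum-cong-≗ (λ i → cong F (ι-restrict mf i)) ⟨
    ∑[ i < h ] F (ι (restrict mf i))     ≡⟨ sum-permute (F ∘ ι) π ⟨
    ∑[ i < h ] F (ι i)                   ∎
    where
    open ≡-Reasoning
    π : Permutation h h
    π = permutation (restrict mf) (restrict mg) (restrict-inverse mg mf fg) (restrict-inverse mf mg gf)

module GaussLemma (h : ℕ) where

  N : ℕ
  N = suc (h + h)

  open Modulo N public
  open Interval h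

  negative : ℕ → Bool
  negative r = does (h <? r)

  absRes : ℕ → ℕ
  absRes r = if negative r then N ∸ r else r

  gauss : ℕ → Bool
  gauss c = ∑[ i < h ] negative (c * ι i % N)

  negative-≤ : ∀ {r} → r ≤ h → negative r ≡ false
  negative-≤ {r} r≤h = dec-false (h <? r) (≤⇒≯ r≤h)

  negative-> : ∀ {r} → h < r → negative r ≡ true
  negative-> {r} h<r = dec-true (h <? r) h<r

  m≤h⇒m%N≡m : ∀ {m} → m ≤ h → m % N ≡ m
  m≤h⇒m%N≡m m≤h = m<n⇒m%n≡m (s≤s (≤-trans m≤h (m≤m+n _ h)))

  interval-nonzero : ∀ {k} → 0 < k → k ≤ h → k % N ≢ 0
  interval-nonzero 0<k k≤h k%N≡0 = >⇒≢ 0<k (trans (sym (m≤h⇒m%N≡m k≤h)) k%N≡0)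

  N∸r≤h : ∀ {r} → h < r → N ∸ r ≤ h
  N∸r≤h {r} h<r = ≤-trans (∸-monoʳ-≤ N h<r) (≤-reflexive (m+n∸m≡n h h))

  h<N∸r : ∀ {r} → r ≤ h → h < N ∸ r
  h<N∸r {r} r≤h = ≤-trans (≤-reflexive (sym N∸h≡1+h)) (∸-monoʳ-≤ N r≤h)
    where
    N∸h≡1+h : N ∸ h ≡ suc h
    N∸h≡1+h = trans (+-∸-assoc 1 (m≤n+m h h)) (cong suc (m+n∸m≡n h h))

  negative-∸ : ∀ r → negative (N ∸ r) ≡ not (negative r)
  negative-∸ r with h <? r
  ... | yes h<r = trans (negative-≤ (N∸r≤h h<r)) (cong not (sym (negative-> h<r)))
  ... | no  h≮r = trans (negative-> (h<N∸r (≮⇒≥ h≮r))) (cong not (sym (negative-≤ (≮⇒≥ h≮r))))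

  absRes-≤ : ∀ {r} → r ≤ h → absRes r ≡ r
  absRes-≤ r≤h rewrite negative-≤ r≤h = refl

  absRes-> : ∀ {r} → h < r → absRes r ≡ N ∸ r
  absRes-> h<r rewrite negative-> h<r = refl

  absRes-range : ∀ {r} → 0 < r → r < N → 0 < absRes r × absRes r ≤ h
  absRes-range {r} 0<r r<N with h <? r
  ... | yes h<r rewrite absRes-> h<r = m<n⇒0<n∸m r<N , N∸r≤h h<r
  ... | no  h≮r rewrite absRes-≤ (≮⇒≥ h≮r) = 0<r , ≮⇒≥ h≮r

  absRes-of-≋ : ∀ c {k} → k ≤ h → c ≋ k → absRes (c % N) ≡ k
  absRes-of-≋ c k≤h c≋k = trans (cong absRes (trans c≋k (m≤h⇒m%N≡m k≤h))) (absRes-≤ k≤h)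

  absRes-of-negation : ∀ c {k} → 0 < k → k ≤ h → c + k ≋ 0 → absRes (c % N) ≡ k
  absRes-of-negation c {k} 0<k k≤h c+k≋0 = begin
    absRes (c % N)     ≡⟨ cong absRes c%N≡N∸k ⟩
    absRes (N ∸ k)     ≡⟨ absRes-> (h<N∸r k≤h) ⟩
    N ∸ (N ∸ k)        ≡⟨ m∸[m∸n]≡n (≤-trans k≤h (m≤n+m h (suc h))) ⟩
    k                  ∎
    where
    open ≡-Reasoning
    c%N≡N∸k : c % N ≡ N ∸ k
    c%N≡N∸k = trans (negate-residue c k c+k≋0 (interval-nonzero 0<k k≤h)) (cong (N ∸_) (m≤h⇒m%N≡m k≤h))

  σ : ℕ → ℕ → ℕ
  σ b k = absRes (b * k % N)

  σ-maps : ∀ {b} → IsUnit b → MapsInterval (σ b)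
  σ-maps {b} ub 0<k k≤h =
    absRes-range (n≢0⇒n>0 (unit-nonzero {b} ub (interval-nonzero 0<k k≤h))) (m%n<n (b * _) N)

  σ-inverse : ∀ {b b′} → b * b′ ≋ 1 → ∀ {k} → 0 < k → k ≤ h → σ b′ (σ b k) ≡ k
  σ-inverse {b} {b′} bb′≋1 {k} 0<k k≤h = undo (b * k % N) b′r≋k (m%n≤n (b * k) N)
    where
    b′r≋k : b′ * (b * k % N) ≋ k
    b′r≋k = begin
      (b′ * (b * k % N)) % N   ≡⟨ *-≋ {b′} {b′} {b * k % N} refl (%-≋ (b * k)) ⟩
      (b′ * (b * k)) % N       ≡⟨ cong (_% N) (trans (sym (*-assoc b′ b k)) (cong (_* k) (*-comm b′ b))) ⟩
      (b * b′ * k) % N         ≡⟨ *-≋ {b * b′} {1} {k} {k} bb′≋1 refl ⟩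
      (1 * k) % N              ≡⟨ cong (_% N) (*-identityˡ k) ⟩
      k % N                    ∎
      where open ≡-Reasoning

    undo : ∀ r → b′ * r ≋ k → r ≤ N → absRes (b′ * absRes r % N) ≡ k
    undo r b′r≋k r≤N with negative r
    ... | false = absRes-of-≋ (b′ * r) k≤h b′r≋k
    ... | true  = absRes-of-negation (b′ * (N ∸ r)) 0<k k≤h
      (trans (+-≋ {b′ * (N ∸ r)} {b′ * (N ∸ r)} {k} refl (sym b′r≋k)) (*∸-negates b′ r≤N))

  negative-*-split : ∀ a b k → a * (b * k % N) % N ≢ 0 →
    negative (a * b * k % N) ≡ negative (b * k % N) xor negative (a * σ b k % N)
  negative-*-split a b k nz = trans (cong negative regroup) (split (b * k % N) nz (m%n≤n (b * k) N))
    where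
    regroup : a * b * k % N ≡ a * (b * k % N) % N
    regroup = trans (cong (_% N) (*-assoc a b k)) (*-≋ {a} {a} {b * k} refl (sym (%-≋ (b * k))))

    split : ∀ r → a * r % N ≢ 0 → r ≤ N → negative (a * r % N) ≡ negative r xor negative (a * absRes r % N)
    split r nz r≤N with negative r
    ... | false = refl
    ... | true  = begin
      negative (a * r % N)             ≡⟨ not-involutive _ ⟨
      not (not (negative (a * r % N))) ≡⟨ cong not (negative-∸ (a * r % N)) ⟨
      not (negative (N ∸ a * r % N))   ≡⟨ cong (not ∘ negative) negated ⟨
      not (negative (a * (N ∸ r) % N)) ∎
      where
      open ≡-Reasoning
      negated : a * (N ∸ r) % N ≡ N ∸ a * r % N
      negated = negate-residue (a * (N ∸ r)) (a * r) (*∸-negates a r≤N) nz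

  gauss-cong : ∀ {a b} → a ≋ b → gauss a ≡ gauss b
  gauss-cong {a} {b} a≋b = sum-cong-≗ (λ i → cong negative (*-≋ {a} {b} {ι i} a≋b refl))

  gauss-* : ∀ {a b} → IsUnit a → IsUnit b → gauss (a * b) ≡ gauss a xor gauss b
  gauss-* {a} {b} ua ub@(b′ , bb′≋1) = begin
    gauss (a * b)
      ≡⟨ sum-cong-≗ (λ i → negative-*-split a b (ι i) (nonzero i)) ⟩
    ∑[ i < h ] (negative (b * ι i % N) xor F (σ b (ι i)))
      ≡⟨ ∑-distrib-+ (λ i → negative (b * ι i % N)) (F ∘ σ b ∘ ι) ⟩
    gauss b xor ∑[ i < h ] F (σ b (ι i))
      ≡⟨ cong (gauss b xor_) permute ⟩
    gauss b xor gauss a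
      ≡⟨ xor-comm (gauss b) (gauss a) ⟩
    gauss a xor gauss b
      ∎
    where
    open ≡-Reasoning
    F : ℕ → Bool
    F k = negative (a * k % N)

    nonzero : ∀ i → a * (b * ι i % N) % N ≢ 0
    nonzero i = unit-nonzero {a} ua
      (unit-nonzero {b} ub (interval-nonzero z<s (toℕ<n i)) ∘ trans (sym (%-≋ (b * ι i))))

    b′b≋1 : b′ * b ≋ 1
    b′b≋1 = trans (cong (_% N) (*-comm b′ b)) bb′≋1

    permute : ∑[ i < h ] F (σ b (ι i)) ≡ gauss a
    permute = ∑-bijection {σ b} {σ b′} (σ-maps {b} ub) (σ-maps {b′} (b , b′b≋1))
                (σ-inverse {b} {b′} bb′≋1) (σ-inverse {b′} {b} b′b≋1) F

  gauss-minusOne : gauss (h + h) ≡ h times true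
  gauss-minusOne = trans (sum-cong-≗ all-negative) (sum-replicate h)
    where
    all-negative : ∀ i → negative ((h + h) * ι i % N) ≡ true
    all-negative i = begin
      negative ((h + h) * k % N) ≡⟨ cong negative (negate-residue ((h + h) * k) k N*k≋0 (interval-nonzero z<s k≤h)) ⟩
      negative (N ∸ k % N)       ≡⟨ cong (λ x → negative (N ∸ x)) (m≤h⇒m%N≡m k≤h) ⟩
      negative (N ∸ k)           ≡⟨ negative-∸ k ⟩
      not (negative k)           ≡⟨ cong not (negative-≤ k≤h) ⟩
      true                       ∎
      where
      open ≡-Reasoning
      k : ℕ
      k = ι i
      k≤h : k ≤ h
      k≤h = toℕ<n i
      N*k≋0 : (h + h) * k + k ≋ 0
      N*k≋0 = trans (cong (_% N) (trans (+-comm ((h + h) * k) k) (*-comm N k))) (*n≋0 k)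

  minusOne-squared : (h + h) * (h + h) ≋ 1
  minusOne-squared = negation-unique {(h + h) * (h + h)} {1} {h + h} square+h+h≋0 n≋0
    where
    square+h+h≋0 : (h + h) * (h + h) + (h + h) ≋ 0
    square+h+h≋0 = trans (cong (_% N) (trans (+-comm ((h + h) * (h + h)) (h + h)) (sym (*-suc (h + h) (h + h)))))
                         (*n≋0 (h + h))

  unit-of-factor : ∀ a c → a * c ≋ h + h → IsUnit a
  unit-of-factor a c ac≋-1 = c * (h + h) , (begin
    a * (c * (h + h)) % N     ≡⟨ cong (_% N) (*-assoc a c (h + h)) ⟨
    a * c * (h + h) % N       ≡⟨ *-≋ {a * c} {h + h} {h + h} {h + h} ac≋-1 refl ⟩
    (h + h) * (h + h) % N     ≡⟨ minusOne-squared ⟩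
    1 % N                     ∎)
    where open ≡-Reasoning

  negative-+[1+h] : ∀ c → (suc h + c) % N ≢ 0 → negative ((suc h + c) % N) ≡ not (negative (c % N))
  negative-+[1+h] c nz = trans (cong negative reduce) (shift (c % N) (m%n<n c N) (nz ∘ trans reduce))
    where
    reduce : (suc h + c) % N ≡ (suc h + c % N) % N
    reduce = +-≋ {suc h} {suc h} {c} refl (sym (%-≋ c))

    shift : ∀ r → r < N → (suc h + r) % N ≢ 0 → negative ((suc h + r) % N) ≡ not (negative r)
    shift r r<N nz with h <? r
    ... | no h≮r = begin
      negative ((suc h + r) % N) ≡⟨ cong negative (m<n⇒m%n≡m 1+h+r<N) ⟩
      negative (suc h + r)       ≡⟨ negative-> (s≤s (m≤m+n h r)) ⟩
      true                       ≡⟨ cong not (negative-≤ r≤h) ⟨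
      not (negative r)           ∎
      where
      open ≡-Reasoning
      r≤h : r ≤ h
      r≤h = ≮⇒≥ h≮r
      1+h+r<N : suc h + r < N
      1+h+r<N = ≤∧≢⇒< (+-monoʳ-≤ (suc h) r≤h) (λ eq → nz (trans (cong (_% N) eq) (n%n≡0 N)))
    ... | yes h<r = begin
      negative ((suc h + r) % N) ≡⟨ cong negative (trans (cong (_% N) wrap) ([m+n]%n≡m%n (r ∸ h) N)) ⟩
      negative ((r ∸ h) % N)     ≡⟨ cong negative (m≤h⇒m%N≡m r∸h≤h) ⟩
      negative (r ∸ h)           ≡⟨ negative-≤ r∸h≤h ⟩
      false                      ≡⟨ cong not (negative-> h<r) ⟨
      not (negative r)           ∎
      where
      open ≡-Reasoning
      r∸h≤h : r ∸ h ≤ h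
      r∸h≤h = ≤-trans (∸-monoˡ-≤ h (s≤s⁻¹ r<N)) (≤-reflexive (m+n∸m≡n h h))
      wrap : suc h + r ≡ r ∸ h + N
      wrap = begin
        suc h + r               ≡⟨ cong (suc h +_) (m+[n∸m]≡n (<⇒≤ h<r)) ⟨
        suc h + (h + (r ∸ h))   ≡⟨ +-assoc (suc h) h (r ∸ h) ⟨
        N + (r ∸ h)             ≡⟨ +-comm N (r ∸ h) ⟩
        r ∸ h + N               ∎

  gauss-d≡false : ∀ d u → d * (u + u) ≡ suc h → gauss d ≡ false
  gauss-d≡false zero    u       ()
  gauss-d≡false (suc d) zero    eq = contradiction (trans (sym (*-zeroʳ d)) eq) 0≢1+n
  gauss-d≡false d@(suc _) u@(suc _) dU≡1+h = begin
    gauss d                  ≡⟨ cong (_xor gauss d) f0≡false ⟨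
    ∑[ i < suc h ] f (toℕ i) ≡⟨ cong (λ m → ∑[ i < m ] f (toℕ i)) dU≡1+h ⟨
    ∑[ i < d * U ] f (toℕ i) ≡⟨ ∑-antiperiodic u d f first-block antiperiodic ⟩
    false                    ∎
    where
    open ≡-Reasoning
    U : ℕ
    U = u + u

    f : ℕ → Bool
    f k = negative (d * k % N)

    f≡false : ∀ {k} → d * k ≤ h → f k ≡ false
    f≡false dk≤h = trans (cong negative (m≤h⇒m%N≡m dk≤h)) (negative-≤ dk≤h)

    f0≡false : f 0 ≡ false
    f0≡false = f≡false (≤-trans (≤-reflexive (*-zeroʳ d)) z≤n)

    first-block : ∀ k → k < U → f k ≡ f 0
    first-block k k<U = trans (f≡false (s≤s⁻¹ (subst (d * k <_) dU≡1+h (*-monoʳ-< d k<U))))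
                              (sym f0≡false)

    d-unit : IsUnit d
    d-unit = U + U , (begin
      d * (U + U) % N           ≡⟨ cong (_% N) (trans (*-distribˡ-+ d U U) (cong₂ _+_ dU≡1+h dU≡1+h)) ⟩
      (suc h + suc h) % N       ≡⟨ cong (_% N) (+-suc (suc h) h) ⟩
      (1 + N) % N               ≡⟨ [m+n]%n≡m%n 1 N ⟩
      1 % N                     ∎)

    antiperiodic : ∀ k → U + k < d * U → f (U + k) ≡ not (f k)
    antiperiodic k lt = begin
      negative (d * (U + k) % N)     ≡⟨ cong (λ m → negative (m % N)) expand ⟩
      negative ((suc h + d * k) % N) ≡⟨ negative-+[1+h] (d * k) (subst (λ m → m % N ≢ 0) expand nonzero) ⟩
      not (f k)                      ∎
      where
      expand : d * (U + k) ≡ suc h + d * k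
      expand = trans (*-distribˡ-+ d U k) (cong (_+ d * k) dU≡1+h)
      nonzero : d * (U + k) % N ≢ 0
      nonzero = unit-nonzero {d} {U + k} d-unit (interval-nonzero z<s (s≤s⁻¹ (subst (U + k <_) dU≡1+h lt)))

module OddModulus (w : ℕ) where

  h : ℕ
  h = suc (w + w)

  open GaussLemma h public

  1+N≡4[1+w] : suc N ≡ 4 * suc w
  1+N≡4[1+w] = identity w
    where
    identity : ∀ w → suc (suc (suc (w + w) + suc (w + w))) ≡ 4 * suc w
    identity = solve-∀

  d*square+1≢0 : ∀ d u t → d * (u + u) ≡ suc h → ¬ (d * t * t + 1 ≋ 0)
  d*square+1≢0 d u t dU≡1+h dtt+1≋0 = contradiction (begin
    true                              ≡⟨ cong (true xor_) (double-times≡false w true) ⟨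
    h times true                      ≡⟨ gauss-minusOne ⟨
    gauss (h + h)                     ≡⟨ gauss-cong {d * t * t} {h + h} dtt≋-1 ⟨
    gauss (d * t * t)                 ≡⟨ gauss-* {d * t} {t} dt-unit t-unit ⟩
    gauss (d * t) xor gauss t         ≡⟨ cong (_xor gauss t) (gauss-* {d} {t} d-unit t-unit) ⟩
    (gauss d xor gauss t) xor gauss t ≡⟨ xor-assoc (gauss d) (gauss t) (gauss t) ⟩
    gauss d xor (gauss t xor gauss t) ≡⟨ cong (gauss d xor_) (xor-same (gauss t)) ⟩
    gauss d xor false                 ≡⟨ xor-identityʳ (gauss d) ⟩
    gauss d                           ≡⟨ gauss-d≡false d u dU≡1+h ⟩
    false                             ∎) λ ()
    where
    open ≡-Reasoning
    dtt≋-1 : d * t * t ≋ h + h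
    dtt≋-1 = negation-unique {d * t * t} {h + h} {1} dtt+1≋0 (trans (cong (_% N) (+-comm (h + h) 1)) n≋0)
    dt-unit : IsUnit (d * t)
    dt-unit = unit-of-factor (d * t) t dtt≋-1
    t-unit : IsUnit t
    t-unit = unit-of-factor t (d * t) (trans (cong (_% N) (*-comm t (d * t))) dtt≋-1)
    d-unit : IsUnit d
    d-unit = unit-of-factor d (t * t) (trans (cong (_% N) (sym (*-assoc d t t))) dtt≋-1)

theorem5 : (m : ℕ) → 0 < m → ¬ HasTypeBSolution (m * m)
theorem5 _ _ (zero , _ , _ , () , _)
theorem5 _ _ (suc _ , zero , _ , _ , () , _)
theorem5 m 0<m (d@(suc _) , u@(suc _) , v , 0<d , 0<u , 0<v , eq) =
  d*square+1≢0 d u (m + m) dU≡1+h d[2m]²+1≋0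
  where
  -- d * u reduces to suc w, since d and u are successors.
  w : ℕ
  w = pred (d * u)
  open OddModulus w

  4du≡1+N : 4 * d * u ≡ suc N
  4du≡1+N = trans (*-assoc 4 d u) (sym 1+N≡4[1+w])

  dU≡1+h : d * (u + u) ≡ suc h
  dU≡1+h = trans (*-distribˡ-+ d u u) (cong suc (+-suc w w))

  4duv≡s+u+v : 4 * d * u * v ≡ m * m + u + v
  4duv≡s+u+v = typeB⇒4duv≡s+u+v (*-mono-< 0<m 0<m) 0<d 0<u 0<v eq

  square-of-double : ∀ d m → d * (m + m) * (m + m) ≡ d * (4 * (m * m))
  square-of-double = solve-∀

  d[2m]²+1≋0 : d * (m + m) * (m + m) + 1 ≋ 0
  d[2m]²+1≋0 = trans (cong (λ x → (x + 1) % N) (square-of-double d m))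
                     (typeB-congruence {N} {d} {u} {v} {m * m} 4du≡1+N 4duv≡s+u+v)
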